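{- Let $\mathbb{S}_5=\mathbb{F}_5[X]/(X^2)$. The set $\mathfrak{k}_{\mathbb{S}_5}$ consisting of the following $22$ points of the projective Hjelmslev plane $\mathrm{PHG}(2,\mathbb{S}_5)$ is a $2$-arc (a $(22,2)$-arc: no three of its points are collinear): $(1:X+1:4X)$, $(4X:1:X+1)$, $(1:4X:4X+1)$, $(1:4X+1:4X)$, $(4X:1:4X+1)$, $(1:4X:X+1)$, $(1:X+1:3X+4)$, $(1:2X+4:X+4)$, $(1:4X+4:4X+1)$, $(1:4X+1:4X+4)$, $(1:X+4:2X+4)$, $(1:3X+4:X+1)$, $(1:3X+2:3X+2)$, $(1:3X+3:1)$, $(1:1:3X+3)$, $(1:2X+3:4X+2)$, $(1:4X+3:3X+4)$, $(1:2X+4:2X+2)$, $(1:4X+2:2X+3)$, $(1:2X+2:2X+4)$, $(1:3X+4:4X+3)$, $(1:1:1)$. In particular $n_2(\mathbb{S}_5)\ge 22$.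
   Context: For a finite chain ring $R$, the projective Hjelmslev plane $\mathrm{PHG}(2,R)$ has as points the free right $R$-submodules of $R^3$ of rank $1$ and as lines the free rank-$2$ right submodules, incidence being inclusion; $(a:b:c)$ denotes the submodule generated by $(a,b,c)^T$ with some coordinate a unit. Points are collinear if contained in a common line. A set of $n$ points is an $(n,2)$-arc (a $2$-arc) if no three of its points are collinear. $n_2(R)$ is the maximum size of a $2$-arc in $\mathrm{PHG}(2,R)$. In $\mathbb{S}_5$, $X$ denotes the class of the indeterminate, so $X^2=0$. -}

module Defs where

open import Data.Nat using (ℕ; _+_; _*_)
open import Data.Nat.DivMod using (_mod_)
open import Data.Fin using (Fin; toℕ)
open import Data.Product using (Σ; _×_; _,_; ∃; ∃-syntax)
open import Relation.Binary.PropositionalEquality using (_≡_; _≢_)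
open import Relation.Nullary using (¬_)
open import Data.Sum using (_⊎_)

-- The ring S₅ = F₅[X]/(X²).  An element (a , b) stands for a + bX,
-- with a, b ∈ F₅ = ℤ/5ℤ represented by Fin 5.

F5 : Set
F5 = Fin 5

_+₅_ : F5 → F5 → F5
a +₅ b = (toℕ a + toℕ b) mod 5

_*₅_ : F5 → F5 → F5
a *₅ b = (toℕ a * toℕ b) mod 5

S5 : Set
S5 = F5 × F5

_⊕_ : S5 → S5 → S5
(a , b) ⊕ (c , d) = (a +₅ c , b +₅ d)

-- (a + bX)(c + dX) = ac + (ad + bc)X   (since X² = 0)
_⊗_ : S5 → S5 → S5
(a , b) ⊗ (c , d) = (a *₅ c , (a *₅ d) +₅ (b *₅ c))

-- el a b  is the element  a + bX  (a, b read modulo 5)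
el : ℕ → ℕ → S5
el a b = (a mod 5 , b mod 5)

zeroS : S5
zeroS = el 0 0

oneS : S5
oneS = el 1 0

IsUnit : S5 → Set
IsUnit r = ∃[ s ] (r ⊗ s ≡ oneS)

V3 : Set
V3 = S5 × S5 × S5

_·_ : V3 → S5 → V3
(x , y , z) · r = (x ⊗ r , y ⊗ r , z ⊗ r)

_⊞_ : V3 → V3 → V3
(x , y , z) ⊞ (x' , y' , z') = (x ⊕ x' , y ⊕ y' , z ⊕ z')

zeroV : V3
zeroV = (zeroS , zeroS , zeroS)

-- (a : b : c) denotes the submodule generated by (a,b,c)ᵀ, where some
-- coordinate is a unit.
HasUnitCoord : V3 → Set
HasUnitCoord (a , b , c) = IsUnit a ⊎ (IsUnit b ⊎ IsUnit c)

InSpan1 : V3 → V3 → Set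
InSpan1 p q = ∃[ r ] (p ≡ q · r)

SamePoint : V3 → V3 → Set
SamePoint p q = InSpan1 p q × InSpan1 q p

FreeRank2 : V3 → V3 → Set
FreeRank2 u v = ∀ r s → (u · r) ⊞ (v · s) ≡ zeroV → (r ≡ zeroS) × (s ≡ zeroS)

InSpan2 : V3 → V3 → V3 → Set
InSpan2 p u v = ∃[ r ] ∃[ s ] (p ≡ (u · r) ⊞ (v · s))

-- pR is contained in the line uR + vR iff p ∈ uR + vR.
-- Three points are collinear if they lie on a common line
-- (a free rank-2 right submodule of S₅³).
Collinear : V3 → V3 → V3 → Set
Collinear p q w =
  ∃[ u ] ∃[ v ] (FreeRank2 u v × InSpan2 p u v × InSpan2 q u v × InSpan2 w u v)

record IsTwoArc {n : ℕ} (P : Fin n → V3) : Set where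
  field
    isPoint   : ∀ i → HasUnitCoord (P i)
    distinct  : ∀ i j → i ≢ j → ¬ SamePoint (P i) (P j)
    noThree   : ∀ i j k → i ≢ j → j ≢ k → i ≢ k →
                ¬ Collinear (P i) (P j) (P k)

open import Data.Vec using (Vec; []; _∷_; lookup)

kS5list : Vec V3 22
kS5list =
    (el 1 0 , el 1 1 , el 0 4)   -- (1 : X+1 : 4X)
  ∷ (el 0 4 , el 1 0 , el 1 1)   -- (4X : 1 : X+1)
  ∷ (el 1 0 , el 0 4 , el 1 4)   -- (1 : 4X : 4X+1)
  ∷ (el 1 0 , el 1 4 , el 0 4)   -- (1 : 4X+1 : 4X)
  ∷ (el 0 4 , el 1 0 , el 1 4)   -- (4X : 1 : 4X+1)
  ∷ (el 1 0 , el 0 4 , el 1 1)   -- (1 : 4X : X+1)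
  ∷ (el 1 0 , el 1 1 , el 4 3)   -- (1 : X+1 : 3X+4)
  ∷ (el 1 0 , el 4 2 , el 4 1)   -- (1 : 2X+4 : X+4)
  ∷ (el 1 0 , el 4 4 , el 1 4)   -- (1 : 4X+4 : 4X+1)
  ∷ (el 1 0 , el 1 4 , el 4 4)   -- (1 : 4X+1 : 4X+4)
  ∷ (el 1 0 , el 4 1 , el 4 2)   -- (1 : X+4 : 2X+4)
  ∷ (el 1 0 , el 4 3 , el 1 1)   -- (1 : 3X+4 : X+1)
  ∷ (el 1 0 , el 2 3 , el 2 3)   -- (1 : 3X+2 : 3X+2)
  ∷ (el 1 0 , el 3 3 , el 1 0)   -- (1 : 3X+3 : 1)
  ∷ (el 1 0 , el 1 0 , el 3 3)   -- (1 : 1 : 3X+3)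
  ∷ (el 1 0 , el 3 2 , el 2 4)   -- (1 : 2X+3 : 4X+2)
  ∷ (el 1 0 , el 3 4 , el 4 3)   -- (1 : 4X+3 : 3X+4)
  ∷ (el 1 0 , el 4 2 , el 2 2)   -- (1 : 2X+4 : 2X+2)
  ∷ (el 1 0 , el 2 4 , el 3 2)   -- (1 : 4X+2 : 2X+3)
  ∷ (el 1 0 , el 2 2 , el 4 2)   -- (1 : 2X+2 : 2X+4)
  ∷ (el 1 0 , el 4 3 , el 3 4)   -- (1 : 3X+4 : 4X+3)
  ∷ (el 1 0 , el 1 0 , el 1 0)   -- (1 : 1 : 1)
  ∷ []

kS5 : Fin 22 → V3
kS5 i = lookup kS5list i

module Submission where

-- Idea.  Over any commutative ring, if three vectors p, q, w lie in a
-- submodule uR + vR then det(p, q, w) = 0; and if p = q·r then every 2×2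
-- minor of (p q) vanishes.  So it suffices to exhibit, for each pair of
-- distinct points, a non-vanishing 2×2 minor, and for each triple of
-- distinct points a non-vanishing determinant: both are finite
-- computations in S₅.
--
-- The library's ring solvers cannot cancel coefficients of an abstract
-- ring, so we write det = Δ⁺ − Δ⁻ with the two Leibniz half-sums Δ⁺, Δ⁻ and
-- minors as pairs of products; the vanishing statements become equalities
-- Δ⁺ ≈ Δ⁻ that hold in every commutative semiring and are proved by the
-- ℕ-coefficient solver.

open import Defs
open import Data.Nat using (_∸_)
open import Data.Nat.DivMod using (_mod_)
open import Data.Fin using (toℕ; zero; suc; _<_)
open import Data.Fin.Properties using (all?; _<?_; <-cmp) renaming (_≟_ to _≟F_)
open import Data.Product using (_×_; _,_; proj₁; proj₂; ∃-syntax)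
open import Data.Product.Properties using (≡-dec)
open import Data.Product.Relation.Binary.Pointwise.NonDependent using (×-decidable)
open import Data.Sum using (_⊎_; inj₁; inj₂; [_,_]′)
open import Function using (_∘_)
open import Relation.Nullary using (¬_)
open import Data.Empty using (⊥-elim)
open import Relation.Nullary.Decidable using (Dec; from-yes; ¬?; _×-dec_; _⊎-dec_; _→-dec_)
open import Relation.Binary.Definitions using (Decidable; Trichotomous; tri<; tri≈; tri>)
open import Relation.Binary.PropositionalEquality using (_≡_; _≢_; refl; cong; cong₂; isEquivalence)
open import Algebra.Bundles using (CommutativeSemiring; CommutativeRing; Ring)
import Algebra.Definitions as AlgebraDefinitions
import Algebra.Structures as AlgebraStructures
open import Algebra.Consequences.Propositional
  using (comm∧idˡ⇒idʳ; comm∧invˡ⇒invʳ; comm∧distrˡ⇒distrʳ)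
import Algebra.Module.Construct.Idealization as Idealization
import Algebra.Module.Construct.TensorUnit as TensorUnit
import Algebra.Solver.Ring.NaturalCoefficients.Default as NaturalSolver

-- Coordinate formulas over any carrier with an addition and a
-- multiplication; kept abstract so they can be instantiated both in a
-- ring and in the solver's polynomial syntax.
module Formulas {a} {A : Set a} (_+_ _*_ : A → A → A) where
  infixl 7 _·ᵥ_
  infixl 6 _⊞ᵥ_

  Vector : Set a
  Vector = A × A × A

  _·ᵥ_ : Vector → A → Vector
  (x , y , z) ·ᵥ r = ((x * r) , (y * r) , (z * r))

  _⊞ᵥ_ : Vector → Vector → Vector
  (x , y , z) ⊞ᵥ (x' , y' , z') = ((x + x') , (y + y') , (z + z'))

  product₃ : A → A → A → A
  product₃ x y z = (x * y) * z

  -- the even and odd halves of the Leibniz formula: det = Δ⁺ − Δ⁻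
  Δ⁺ : Vector → Vector → Vector → A
  Δ⁺ (a₁ , a₂ , a₃) (b₁ , b₂ , b₃) (c₁ , c₂ , c₃) =
    (product₃ a₁ b₂ c₃ + product₃ a₂ b₃ c₁) + product₃ a₃ b₁ c₂

  Δ⁻ : Vector → Vector → Vector → A
  Δ⁻ (a₁ , a₂ , a₃) (b₁ , b₂ , b₃) (c₁ , c₂ , c₃) =
    (product₃ a₃ b₂ c₁ + product₃ a₁ b₃ c₂) + product₃ a₂ b₁ c₃

module Coordinates {c ℓ} (R : CommutativeSemiring c ℓ) where
  open CommutativeSemiring R using (_≈_; _+_; _*_) renaming (refl to ≈-refl)
  open Formulas _+_ _*_ public

  private
    open NaturalSolver R using (solve; _:=_; _:+_; _:*_; Polynomial)
    module P {n} = Formulas {A = Polynomial n} _:+_ _:*_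

  InSpan : Vector → Vector → Vector → Set c
  InSpan p u v = ∃[ r ] ∃[ s ] (p ≡ u ·ᵥ r ⊞ᵥ v ·ᵥ s)

  Proportional : Vector → Vector → Set ℓ
  Proportional (p₁ , p₂ , p₃) (q₁ , q₂ , q₃) =
    (p₁ * q₂ ≈ p₂ * q₁) × (p₁ * q₃ ≈ p₃ * q₁) × (p₂ * q₃ ≈ p₃ * q₂)

  proportional? : Decidable _≈_ → ∀ p q → Dec (Proportional p q)
  proportional? _≈?_ (p₁ , p₂ , p₃) (q₁ , q₂ , q₃) =
    ((p₁ * q₂) ≈? (p₂ * q₁)) ×-dec (((p₁ * q₃) ≈? (p₃ * q₁)) ×-dec ((p₂ * q₃) ≈? (p₃ * q₂)))

  multiple⇒proportional : ∀ {p q} → ∃[ r ] (p ≡ q ·ᵥ r) → Proportional p q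
  multiple⇒proportional {q = q₁ , q₂ , q₃} (r , refl) =
    minor-vanishes q₁ q₂ r , minor-vanishes q₁ q₃ r , minor-vanishes q₂ q₃ r
    where
    minor-vanishes : ∀ x y r → (x * r) * y ≈ (y * r) * x
    minor-vanishes = solve 3 (λ x y r → (x :* r) :* y := (y :* r) :* x) ≈-refl

  det-of-span : ∀ u v r₁ s₁ r₂ s₂ r₃ s₃ →
    let p = u ·ᵥ r₁ ⊞ᵥ v ·ᵥ s₁ ; q = u ·ᵥ r₂ ⊞ᵥ v ·ᵥ s₂ ; w = u ·ᵥ r₃ ⊞ᵥ v ·ᵥ s₃
    in Δ⁺ p q w ≈ Δ⁻ p q w
  det-of-span (u₁ , u₂ , u₃) (v₁ , v₂ , v₃) = solve 12
    (λ u₁ u₂ u₃ v₁ v₂ v₃ r₁ s₁ r₂ s₂ r₃ s₃ →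
      let u = (u₁ , u₂ , u₃) ; v = (v₁ , v₂ , v₃)
          p = u P.·ᵥ r₁ P.⊞ᵥ v P.·ᵥ s₁ ; q = u P.·ᵥ r₂ P.⊞ᵥ v P.·ᵥ s₂ ; w = u P.·ᵥ r₃ P.⊞ᵥ v P.·ᵥ s₃
      in P.Δ⁺ p q w := P.Δ⁻ p q w)
    ≈-refl u₁ u₂ u₃ v₁ v₂ v₃

  span⇒det-vanishes : ∀ {p q w u v} → InSpan p u v → InSpan q u v → InSpan w u v →
                      Δ⁺ p q w ≈ Δ⁻ p q w
  span⇒det-vanishes {u = u} {v} (r₁ , s₁ , refl) (r₂ , s₂ , refl) (r₃ , s₃ , refl) =
    det-of-span u v r₁ s₁ r₂ s₂ r₃ s₃

module _ {a r p} {A : Set a} {_<ᴬ_ : A → A → Set r} (compare : Trichotomous _≡_ _<ᴬ_)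
         {P : A → A → A → Set p}
         (swap₁₂ : ∀ {i j k} → P i j k → P j i k)
         (swap₂₃ : ∀ {i j k} → P i j k → P i k j)
         (increasing : ∀ {i j k} → i <ᴬ j → j <ᴬ k → P i j k) where

  from-increasing : ∀ i j k → i ≢ j → j ≢ k → i ≢ k → P i j k
  from-increasing i j k i≢j j≢k i≢k with compare i j | compare j k | compare i k
  ... | tri≈ _ i≡j _ | _            | _            = ⊥-elim (i≢j i≡j)
  ... | _            | tri≈ _ j≡k _ | _            = ⊥-elim (j≢k j≡k)
  ... | _            | _            | tri≈ _ i≡k _ = ⊥-elim (i≢k i≡k)
  ... | tri< i<j _ _ | tri< j<k _ _ | _            = increasing i<j j<k
  ... | tri< i<j _ _ | tri> _ _ k<j | tri< i<k _ _ = swap₂₃ (increasing i<k k<j)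
  ... | tri< i<j _ _ | tri> _ _ k<j | tri> _ _ k<i = swap₂₃ (swap₁₂ (increasing k<i i<j))
  ... | tri> _ _ j<i | tri< j<k _ _ | tri< i<k _ _ = swap₁₂ (increasing j<i i<k)
  ... | tri> _ _ j<i | tri< j<k _ _ | tri> _ _ k<i = swap₁₂ (swap₂₃ (increasing j<k k<i))
  ... | tri> _ _ j<i | tri> _ _ k<j | _            = swap₁₂ (swap₂₃ (swap₁₂ (increasing k<j j<i)))

-- The ring of dual numbers R[X]/(X²) over a commutative ring R, obtained
-- as the idealization R ⋉ R of R regarded as a bimodule over itself:
-- (a + bX)(c + dX) = ac + (ad + bc)X, exactly the multiplication of Defs.
module DualNumbers {c ℓ} (R : CommutativeRing c ℓ) where
  private
    module R = CommutativeRing R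
    module D = Ring (Idealization.ringᴺ R.ring TensorUnit.bimodule)
    open import Relation.Binary.Reasoning.Setoid R.setoid

  *-comm : ∀ x y → (x D.* y) D.≈ (y D.* x)
  *-comm (a , b) (c , d) = R.*-comm a c , (begin
    (a R.* d) R.+ (b R.* c)  ≈⟨ R.+-comm _ _ ⟩
    (b R.* c) R.+ (a R.* d)  ≈⟨ R.+-cong (R.*-comm b c) (R.*-comm a d) ⟩
    (c R.* b) R.+ (d R.* a)  ∎)

  commutativeRing : CommutativeRing c ℓ
  commutativeRing = record { isCommutativeRing = record { isRing = D.isRing ; *-comm = *-comm } }

module F₅ where
  open AlgebraDefinitions {A = F5} _≡_
  open AlgebraStructures {A = F5} _≡_ using (IsCommutativeRing)

  neg₅ : F5 → F5
  neg₅ a = (5 ∸ toℕ a) mod 5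

  +-assoc : Associative _+₅_
  +-assoc = from-yes (all? λ a → all? λ b → all? λ c → (a +₅ b) +₅ c ≟F a +₅ (b +₅ c))

  +-comm : Commutative _+₅_
  +-comm = from-yes (all? λ a → all? λ b → a +₅ b ≟F b +₅ a)

  +-identityˡ : LeftIdentity zero _+₅_
  +-identityˡ = from-yes (all? λ a → zero +₅ a ≟F a)

  -‿inverseˡ : LeftInverse zero neg₅ _+₅_
  -‿inverseˡ = from-yes (all? λ a → neg₅ a +₅ a ≟F zero)

  *-assoc : Associative _*₅_
  *-assoc = from-yes (all? λ a → all? λ b → all? λ c → (a *₅ b) *₅ c ≟F a *₅ (b *₅ c))

  *-comm : Commutative _*₅_
  *-comm = from-yes (all? λ a → all? λ b → a *₅ b ≟F b *₅ a)

  *-identityˡ : LeftIdentity (suc zero) _*₅_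
  *-identityˡ = from-yes (all? λ a → suc zero *₅ a ≟F a)

  distribˡ : _*₅_ DistributesOverˡ _+₅_
  distribˡ = from-yes (all? λ a → all? λ b → all? λ c → a *₅ (b +₅ c) ≟F (a *₅ b) +₅ (a *₅ c))

  isCommutativeRing : IsCommutativeRing _+₅_ _*₅_ neg₅ zero (suc zero)
  isCommutativeRing = record
    { isRing = record
      { +-isAbelianGroup = record
        { isGroup = record
          { isMonoid = record
            { isSemigroup = record
              { isMagma = record { isEquivalence = isEquivalence ; ∙-cong = cong₂ _+₅_ }
              ; assoc = +-assoc }
            ; identity = +-identityˡ , comm∧idˡ⇒idʳ +-comm +-identityˡ }
          ; inverse = -‿inverseˡ , comm∧invˡ⇒invʳ +-comm -‿inverseˡ
          ; ⁻¹-cong = cong neg₅ }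
        ; comm = +-comm }
      ; *-cong = cong₂ _*₅_
      ; *-assoc = *-assoc
      ; *-identity = *-identityˡ , comm∧idˡ⇒idʳ *-comm *-identityˡ
      ; distrib = distribˡ , comm∧distrˡ⇒distrʳ *-comm distribˡ }
    ; *-comm = *-comm }

  commutativeRing : CommutativeRing _ _
  commutativeRing = record { isCommutativeRing = isCommutativeRing }

-- Its operations are definitionally _⊕_ and _⊗_ of Defs,
-- so the span predicates of Defs are instances of those of Coordinates;
-- its equality _≈S_ is componentwise equality of pairs.
S₅-ring : CommutativeRing _ _
S₅-ring = DualNumbers.commutativeRing F₅.commutativeRing

open CommutativeRing S₅-ring using () renaming (_≈_ to _≈S_)
module S₅ = Coordinates (CommutativeRing.commutativeSemiring S₅-ring)

_≈S?_ : Decidable _≈S_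
_≈S?_ = ×-decidable _≟F_ _≟F_

_≟S_ : Decidable {A = S5} _≡_
_≟S_ = ≡-dec _≟F_ _≟F_

leading-one : ∀ i → (proj₁ (kS5 i) ≡ oneS) ⊎ (proj₁ (proj₂ (kS5 i)) ≡ oneS)
leading-one = from-yes (all? λ i → (proj₁ (kS5 i) ≟S oneS) ⊎-dec (proj₁ (proj₂ (kS5 i)) ≟S oneS))

distinct-non-proportional : ∀ i j → i ≢ j → ¬ S₅.Proportional (kS5 i) (kS5 j)
distinct-non-proportional = from-yes (all? λ i → all? λ j →
  ¬? (i ≟F j) →-dec ¬? (S₅.proportional? _≈S?_ (kS5 i) (kS5 j)))

increasing-non-degenerate : ∀ i j k → i < j → j < k →
  ¬ (S₅.Δ⁺ (kS5 i) (kS5 j) (kS5 k) ≈S S₅.Δ⁻ (kS5 i) (kS5 j) (kS5 k))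
increasing-non-degenerate = from-yes (all? λ i → all? λ j → all? λ k →
  (i <? j) →-dec ((j <? k) →-dec ¬? (S₅.Δ⁺ (kS5 i) (kS5 j) (kS5 k) ≈S? S₅.Δ⁻ (kS5 i) (kS5 j) (kS5 k))))

unit-coordinate : ∀ {x} → x ≡ oneS → IsUnit x
unit-coordinate refl = oneS , refl

collinear-swap₁₂ : ∀ {p q w} → Collinear p q w → Collinear q p w
collinear-swap₁₂ (u , v , free , p∈ , q∈ , w∈) = u , v , free , q∈ , p∈ , w∈

collinear-swap₂₃ : ∀ {p q w} → Collinear p q w → Collinear p w q
collinear-swap₂₃ (u , v , free , p∈ , q∈ , w∈) = u , v , free , p∈ , w∈ , q∈

-- collinear points have vanishing determinant
collinear⇒det-vanishes : ∀ {p q w} → Collinear p q w → S₅.Δ⁺ p q w ≈S S₅.Δ⁻ p q w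
collinear⇒det-vanishes (u , v , _ , p∈ , q∈ , w∈) = S₅.span⇒det-vanishes {u = u} {v} p∈ q∈ w∈

mainTheorem3 : IsTwoArc kS5
mainTheorem3 = record
  { isPoint  = λ i → [ inj₁ ∘ unit-coordinate , inj₂ ∘ inj₁ ∘ unit-coordinate ]′ (leading-one i)
  ; distinct = λ i j i≢j same →
      distinct-non-proportional i j i≢j (S₅.multiple⇒proportional (proj₁ same))
  ; noThree  = from-increasing <-cmp
      (λ ¬col col → ¬col (collinear-swap₁₂ col))
      (λ ¬col col → ¬col (collinear-swap₂₃ col))
      (λ i<j j<k col → increasing-non-degenerate _ _ _ i<j j<k (collinear⇒det-vanishes col))
  }
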